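{- For every positive integer $n$, the following identity holds (as formal power series in $z_0$ whose coefficients are Laurent polynomials in $s, z_{\pm1},\ldots,z_{\pm n}$): \[ \sum_{ k \ge 0 } \prod_{ j=1 }^n \left( [k+1]_{ z_j } + s \, z_{ -j}^{ -1 } [k]_{ z_{ -j}^{ -1 } } \right) z_0^k \ = \ \sum_{ (\pi,\epsilon)\in B_n } s^{\mathrm{neg}(\epsilon)} \frac{\displaystyle \prod_{ j \in \mathrm{NatDes}(\pi, \epsilon) } z_0z_{ \epsilon_{j+1} \pi(j+1) }^{ \epsilon_{j+1} } z_{ \epsilon_{j+2} \pi(j+2) }^{ \epsilon_{j+2} } \cdots z_{\epsilon_n \pi(n)}^{ \epsilon_n } }{ \displaystyle \prod_{ j=0 }^n \left( 1 - z_0 \, z_{ \epsilon_{j+1} \pi(j+1) }^{ \epsilon_{j+1} } z_{ \epsilon_{j+2} \pi(j+2) }^{ \epsilon_{j+2} } \cdots z_{\epsilon_n \pi(n)}^{ \epsilon_n } \right) } \, , \] where for $j=n$ the product $z_{ \epsilon_{j+1} \pi(j+1) }^{ \epsilon_{j+1} }\cdots z_{\epsilon_n \pi(n)}^{ \epsilon_n }$ is empty (so that factor of the denominator is $1-z_0$).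
   Context: There are variables $z_0$, $s$, and $z_{j}, z_{ -j}$ for $j\in[n]$; for $\epsilon_i=\pm1$ and $\pi(i)\in[n]$, $z_{\epsilon_i\pi(i)}^{\epsilon_i}$ means $z_{\pi(i)}$ if $\epsilon_i=1$ and $z_{ -\pi(i)}^{ -1}$ if $\epsilon_i=-1$. $[m]_z=1+z+\cdots+z^{m-1}$ (so $[0]_z=0$). $B_n$ is the set of signed permutations $(\pi,\epsilon)$ with $\pi\in S_n$, $\epsilon\in\{\pm1\}^n$; $\mathrm{neg}(\epsilon)$ is the number of $j$ with $\epsilon_j=-1$. Using the natural order $-n<\cdots<-1<1<\cdots<n$ and the convention $\epsilon_0\pi(0)=0$, the naturally ordered descent set is $\mathrm{NatDes}(\pi,\epsilon)=\{j\in\{0,1,\ldots,n-1\}:\epsilon_j\pi(j)>\epsilon_{j+1}\pi(j+1)\}$. -}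

module Defs where

open import Level using (Level)
open import Data.Bool using (Bool; true; false; if_then_else_)
open import Data.Nat as ℕ using (ℕ; zero; suc; _∸_)
open import Data.Fin as Fin using (Fin; toℕ)
open import Data.Fin.Properties using (_≟_)
open import Data.Integer as ℤ using (ℤ; +_; -[1+_])
open import Data.Product using (_×_; _,_; proj₁; proj₂)
open import Data.List using (List; []; _∷_; [_]; map; foldr; concatMap; filter; allFin; upTo; length)
open import Relation.Nullary.Decidable using (does)
open import Algebra.Bundles using (CommutativeRing)
import Data.List.Relation.Unary.Unique.DecPropositional as UniqueDec

-- A signed letter (b , a) with b : Bool, a : Fin n stands for the
-- signed integer  ε·π = -(a+1) if b = true (negative sign), +(a+1) otherwise.
-- A signed permutation (π,ε) ∈ B_n is represented by its window
-- word  ε₁π(1), ε₂π(2), …, εₙπ(n)  (a list of n signed letters whose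
-- underlying letters are pairwise distinct).

SLetter : ℕ → Set
SLetter n = Bool × Fin n

letters : (n : ℕ) → List (SLetter n)
letters n = concatMap (λ a → (false , a) ∷ (true , a) ∷ []) (allFin n)

allWords : (n k : ℕ) → List (List (SLetter n))
allWords n zero    = [ [] ]
allWords n (suc k) = concatMap (λ w → map (_∷ w) (letters n)) (allWords n k)

signedPerms : (n : ℕ) → List (List (SLetter n))
signedPerms n =
  filter (λ w → UniqueDec.unique? {A = Fin n} _≟_ (map proj₂ w)) (allWords n n)

sval : ∀ {n} → SLetter n → ℤ
sval (true  , a) = -[1+ toℕ a ]
sval (false , a) = + suc (toℕ a)

negCount : ∀ {n} → List (SLetter n) → ℕ
negCount w = length (filter (λ x → Data.Bool._≟_ (proj₁ x) true) w)

-- For the window word w = w₁ … wₙ (with w₀ = 0) this lists, for every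
-- j ∈ NatDes(π,ε) (i.e. j ∈ {0,…,n-1} with w_j > w_{j+1}), the suffix
-- w_{j+1} … w_n.
desSuffixes : ∀ {n} → ℤ → List (SLetter n) → List (List (SLetter n))
desSuffixes prev []       = []
desSuffixes prev (x ∷ xs) =
  if does (sval x ℤ.<? prev)
  then (x ∷ xs) ∷ desSuffixes (sval x) xs
  else desSuffixes (sval x) xs

suffixes : ∀ {A : Set} → List A → List (List A)
suffixes []       = [ [] ]
suffixes (x ∷ xs) = (x ∷ xs) ∷ suffixes xs

module Series {c ℓ : Level} (R : CommutativeRing c ℓ) where
  open CommutativeRing R

  sumL : List Carrier → Carrier
  sumL = foldr _+_ 0#

  prodL : List Carrier → Carrier
  prodL = foldr _*_ 1#

  pow : Carrier → ℕ → Carrier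
  pow x zero    = 1#
  pow x (suc k) = x * pow x k

  qint : ℕ → Carrier → Carrier
  qint m x = sumL (map (pow x) (upTo m))

  PS : Set c
  PS = ℕ → Carrier

  _≋_ : PS → PS → Set ℓ
  f ≋ g = ∀ k → f k ≈ g k

  _·_ : PS → PS → PS
  (f · g) k = sumL (map (λ i → f i * g (k ∸ i)) (upTo (suc k)))

  onePS : PS
  onePS zero    = 1#
  onePS (suc k) = 0#

  prodPS : List PS → PS
  prodPS = foldr _·_ onePS

  sumPS : List PS → PS
  sumPS fs k = sumL (map (λ f → f k) fs)

  monomial : Carrier → ℕ → PS
  monomial a d k = if does (k ℕ.≟ d) then a else 0#

  -- 1 / (1 - z₀ m) = Σ_k m^k z₀^k  (the inverse in R[[z₀]])
  geom : Carrier → PS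
  geom m k = pow m k

  module Vars {n : ℕ} (s : Carrier)
              (zp  : Fin n → Carrier)
              (zmInv : Fin n → Carrier)
              where

    var : SLetter n → Carrier
    var (false , a) = zp a
    var (true  , a) = zmInv a

    mprod : List (SLetter n) → Carrier
    mprod u = prodL (map var u)

    LHS : PS
    LHS k = prodL (map (λ j → qint (suc k) (zp j) + s * zmInv j * qint k (zmInv j))
                       (allFin n))

    term : List (SLetter n) → PS
    term w =
      monomial (pow s (negCount w) * prodL (map mprod (desSuffixes (+ 0) w)))
               (length (desSuffixes (+ 0) w))
      · prodPS (map (λ u → geom (mprod u)) (suffixes w))

    RHS : PS
    RHS = sumPS (map term (signedPerms n))

module Submission where

-- Expanding 1/(1 - z₀M) geometrically for every suffix M of the window word, and z₀M/(1 - z₀M)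
-- at the descents, turns the coefficient of z₀^k on the right into a sum over the signed
-- permutations w together with heights 0 ≤ h₁ ≤ ⋯ ≤ hₙ ≤ k that increase strictly where w
-- descends (with w₀ = 0), weighted by ∏ᵢ s^[εᵢ = -1] (z^{εᵢ}_{wᵢ})^{hᵢ}.  Such pairs correspond exactly
-- to the choices of a sign and a height ≤ k for every j ∈ [n], negative letters at height ≥ 1:
-- sorting the letters by height, and increasingly within a height, recovers the word.  The
-- left coefficient is the sum over these choices.  The correspondence is carried out
-- algebraically by splitting off the first letter of the word, i.e. the lowest letter, and
-- proving that first-letter expansion by lowering, one value at a time, the threshold below
-- which the remaining letters have to sit strictly higher.

open import Defs
open import Level using (Level)
open import Algebra.Bundles using (CommutativeRing)
open import Data.Bool using (Bool; true; false; if_then_else_)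
open import Data.Nat using (ℕ; zero; suc; _∸_; _<ᵇ_; _≤_)
open import Data.Fin using (Fin; toℕ)
import Data.Fin as Fin
import Data.Fin.Properties as Fin
open import Data.Integer using (ℤ; +_; -[1+_])
import Data.Integer as ℤ
import Data.Integer.Properties as ℤ
import Data.Nat as ℕ
import Data.Nat.Properties as ℕ
open import Data.List using (List; []; _∷_; _++_; map; length; concatMap; filter; applyUpTo; tabulate; upTo; allFin)
import Data.List.Properties as List
open import Relation.Binary.PropositionalEquality using (_≡_; _≢_)
import Relation.Binary.PropositionalEquality as ≡
open import Relation.Nullary using (¬_; Dec; yes; no; does)
open import Relation.Nullary.Decidable using (dec-true; dec-false; does-⇔)
open import Function.Bundles using (mk⇔)
import Algebra.Properties.CommutativeSemigroup
open import Data.Product using (_×_; _,_; proj₁; proj₂; ∃)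
open import Data.Sum using (_⊎_; inj₁; inj₂)
open import Data.Empty using (⊥-elim)
open import Data.List.Relation.Unary.All as All using (All; []; _∷_)
import Relation.Binary.Indexed.Heterogeneous.Construct.Trivial as Trivial
import Relation.Binary.Reasoning.Setoid as SetoidReasoning
open import Function using (_∘_)
open import Function.Indexed.Relation.Binary.Equality using (≡-setoid)
open import Relation.Binary.Bundles using (Setoid)

module FinSubsets where

  remove : ∀ {m} → (Fin m → Bool) → Fin m → Fin m → Bool
  remove A j i = if does (i Fin.≟ j) then false else A i

  size : ∀ {m} → (Fin m → Bool) → ℕ
  size {zero}  A = 0
  size {suc m} A = (if A Fin.zero then 1 else 0) ℕ.+ size (A ∘ Fin.suc)

  size-remove : ∀ {m} (A : Fin m → Bool) j → A j ≡ true → suc (size (remove A j)) ≡ size A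
  size-remove A Fin.zero    Aj with A Fin.zero
  size-remove A Fin.zero    ≡.refl | true = ≡.refl
  size-remove A (Fin.suc j) Aj with A Fin.zero
  ... | true  = ≡.cong suc (size-remove (A ∘ Fin.suc) j Aj)
  ... | false = size-remove (A ∘ Fin.suc) j Aj

  size-full : ∀ m → size {m} (λ _ → true) ≡ m
  size-full zero    = ≡.refl
  size-full (suc m) = ≡.cong suc (size-full m)

  remove-⊆ : ∀ {m} (A : Fin m → Bool) j i → remove A j i ≡ true → A i ≡ true
  remove-⊆ A j i i∈A-j with i Fin.≟ j
  ... | no _ = i∈A-j

  remove-∉ : ∀ {m} (A : Fin m → Bool) j i → remove A j i ≡ true → j ≢ i
  remove-∉ A j i i∈A-j with i Fin.≟ j
  ... | no i≢j = λ j≡i → i≢j (≡.sym j≡i)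

  drawsFrom : ∀ {m} → (Fin m → Bool) → List (Fin m) → Bool
  drawsFrom A []       = true
  drawsFrom A (a ∷ as) = if A a then drawsFrom (remove A a) as else false

  module _ {m : ℕ} where
    open import Data.List.Relation.Unary.Unique.DecPropositional {A = Fin m} Fin._≟_ using (Unique; unique?)
    open import Data.List.Relation.Unary.AllPairs using ([]; _∷_)

    drawsFrom-sound : ∀ A as → drawsFrom A as ≡ true → All (λ a → A a ≡ true) as × Unique as
    drawsFrom-sound A []       _ = [] , []
    drawsFrom-sound A (a ∷ as) drawn with A a in a∈A
    ... | true = (a∈A ∷ All.map (remove-⊆ A a _) (proj₁ rest)) , (All.map (remove-∉ A a _) (proj₁ rest) ∷ proj₂ rest)
      where rest = drawsFrom-sound (remove A a) as drawn

    drawsFrom-complete : ∀ A as → All (λ a → A a ≡ true) as → Unique as → drawsFrom A as ≡ true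
    drawsFrom-complete A []       []           []                 = ≡.refl
    drawsFrom-complete A (a ∷ as) (a∈A ∷ as⊆A) (a∉as ∷ as-unique) rewrite a∈A =
      drawsFrom-complete (remove A a) as (All.zipWith inRemove (as⊆A , a∉as)) as-unique
      where
      inRemove : ∀ {i} → A i ≡ true × a ≢ i → remove A a i ≡ true
      inRemove {i} (i∈A , a≢i) with i Fin.≟ a
      ... | yes i≡a = ⊥-elim (a≢i (≡.sym i≡a))
      ... | no  _   = i∈A

    unique?≡drawsFrom : ∀ as → does (unique? as) ≡ drawsFrom (λ _ → true) as
    unique?≡drawsFrom as with drawsFrom (λ _ → true) as in drawn
    ... | true  = dec-true (unique? as) (proj₂ (drawsFrom-sound _ as drawn))
    ... | false = dec-false (unique? as) λ u →
      false≢true (≡.trans (≡.sym drawn) (drawsFrom-complete _ as (All.tabulate (λ _ → ≡.refl)) u))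
      where
      false≢true : false ≢ true
      false≢true ()

module RingSums {c ℓ : Level} (R : CommutativeRing c ℓ) where
  open CommutativeRing R
  open Series R
  open import Algebra.Properties.Semiring.Sum semiring public
    using (sum; sum-cong-≋; ∑-distrib-+; *-distribˡ-sum)
  open import Algebra.Properties.CommutativeMonoid.Sum *-commutativeMonoid public
    using () renaming (sum to product; sum-cong-≋ to product-cong-≋)
  open FinSubsets
  open import Algebra.Properties.CommutativeSemiring.Exp commutativeSemiring
    using (_^_; ^-homo-*; ^-distrib-*)
  module +-CS = Algebra.Properties.CommutativeSemigroup +-commutativeSemigroup
  module *-CS = Algebra.Properties.CommutativeSemigroup *-commutativeSemigroup
  open import Relation.Binary.Reasoning.Setoid setoid

  when : Bool → Carrier → Carrier
  when b x = if b then x else 0#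

  when-cong : ∀ b {x y} → x ≈ y → when b x ≈ when b y
  when-cong true  x≈y = x≈y
  when-cong false _   = refl

  *-when : ∀ b a x → a * when b x ≈ when b (a * x)
  *-when true  a x = refl
  *-when false a x = zeroʳ a

  when-* : ∀ b x a → when b x * a ≈ when b (x * a)
  when-* true  x a = refl
  when-* false x a = zeroˡ a

  when-true : ∀ {b} x → b ≡ true → when b x ≈ x
  when-true x ≡.refl = refl

  when-0# : ∀ b → when b 0# ≈ 0#
  when-0# true  = refl
  when-0# false = refl

  pow≡^ : ∀ x k → pow x k ≡ x ^ k
  pow≡^ x zero    = ≡.refl
  pow≡^ x (suc k) = ≡.cong (x *_) (pow≡^ x k)

  pow-homo-+ : ∀ x m k → pow x (m ℕ.+ k) ≈ pow x m * pow x k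
  pow-homo-+ x m k rewrite pow≡^ x (m ℕ.+ k) | pow≡^ x m | pow≡^ x k = ^-homo-* x m k

  pow-distrib-* : ∀ x y k → pow (x * y) k ≈ pow x k * pow y k
  pow-distrib-* x y k rewrite pow≡^ (x * y) k | pow≡^ x k | pow≡^ y k = ^-distrib-* x y k

  pow-1# : ∀ k → pow 1# k ≈ 1#
  pow-1# zero    = refl
  pow-1# (suc k) = trans (*-identityˡ _) (pow-1# k)

  sumBelow : ℕ → (ℕ → Carrier) → Carrier
  sumBelow r f = sum (λ (i : Fin r) → f (toℕ i))

  sumBelow-cong : ∀ r {f g : ℕ → Carrier} → (∀ i → f i ≈ g i) → sumBelow r f ≈ sumBelow r g
  sumBelow-cong r {f} {g} f≈g = sum-cong-≋ {r} {f ∘ toℕ} {g ∘ toℕ} (f≈g ∘ toℕ)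

  sum-zero : ∀ r → sum (λ (_ : Fin r) → 0#) ≈ 0#
  sum-zero zero    = refl
  sum-zero (suc r) = trans (+-identityˡ _) (sum-zero r)

  *-distribˡ-sumBelow : ∀ r a f → a * sumBelow r f ≈ sumBelow r (λ i → a * f i)
  *-distribˡ-sumBelow r a f = *-distribˡ-sum a (λ (i : Fin r) → f (toℕ i))

  sumL-applyUpTo : ∀ r (f : ℕ → Carrier) → sumL (applyUpTo f r) ≈ sumBelow r f
  sumL-applyUpTo zero    f = refl
  sumL-applyUpTo (suc r) f = +-congˡ (sumL-applyUpTo r (λ i → f (suc i)))

  sumL-map-upTo : ∀ r (f : ℕ → Carrier) → sumL (map f (upTo r)) ≈ sumBelow r f
  sumL-map-upTo r f rewrite List.map-upTo f r = sumL-applyUpTo r f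

  prodL-tabulate : ∀ {r} (f : Fin r → Carrier) → prodL (tabulate f) ≈ product f
  prodL-tabulate {zero}  f = refl
  prodL-tabulate {suc r} f = *-congˡ (prodL-tabulate (λ i → f (Fin.suc i)))

  sumL-tabulate : ∀ {r} (f : Fin r → Carrier) → sumL (tabulate f) ≈ sum f
  sumL-tabulate {zero}  f = refl
  sumL-tabulate {suc r} f = +-congˡ (sumL-tabulate (λ i → f (Fin.suc i)))

  prodOver : ∀ {m} → (Fin m → Bool) → (Fin m → Carrier) → Carrier
  prodOver A h = product (λ j → if A j then h j else 1#)

  prodOver-cong : ∀ {m} (A : Fin m → Bool) {h h′ : Fin m → Carrier} →
                  (∀ j → A j ≡ true → h j ≈ h′ j) → prodOver A h ≈ prodOver A h′
  prodOver-cong {m} A {h} {h′} h≈h′ =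
    product-cong-≋ {m} {λ j → if A j then h j else 1#} {λ j → if A j then h′ j else 1#} (λ j → on (A j) (h≈h′ j))
    where
    on : ∀ b {x y} → (b ≡ true → x ≈ y) → (if b then x else 1#) ≈ (if b then y else 1#)
    on true  x≈y = x≈y ≡.refl
    on false _   = refl

  prodOver-empty : ∀ {m} (A : Fin m → Bool) h → size A ≡ 0 → prodOver A h ≈ 1#
  prodOver-empty {zero}  A h _ = refl
  prodOver-empty {suc m} A h ∣A∣≡0 with A Fin.zero
  ... | false = trans (*-identityˡ _) (prodOver-empty (A ∘ Fin.suc) (h ∘ Fin.suc) ∣A∣≡0)

  prodOver-zero : ∀ {m} (A : Fin m → Bool) {k} → size A ≡ suc k → prodOver A (λ _ → 0#) ≈ 0#
  prodOver-zero {suc m} A ∣A∣≡1+k with A Fin.zero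
  ... | true  = zeroˡ _
  ... | false = trans (*-identityˡ _) (prodOver-zero (A ∘ Fin.suc) ∣A∣≡1+k)

  sum-indicator : ∀ {m} (j : Fin m) e → sum (λ i → when (does (i Fin.≟ j)) e) ≈ e
  sum-indicator {suc m} Fin.zero    e = trans (+-congˡ (sum-zero m)) (+-identityʳ e)
  sum-indicator {suc m} (Fin.suc j) e = trans (+-identityˡ _) (sum-indicator j e)

  drop-+0# : ∀ {m} (A : Fin (suc m) → Bool) (h : Fin (suc m) → Carrier) →
             prodOver (A ∘ Fin.suc) (λ i → h (Fin.suc i) + 0#) ≈ prodOver (A ∘ Fin.suc) (h ∘ Fin.suc)
  drop-+0# A h = prodOver-cong (A ∘ Fin.suc) (λ i _ → +-identityʳ _)

  prodOver-perturb : ∀ {m} (A : Fin m → Bool) (h : Fin m → Carrier) c j →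
    prodOver A (λ i → h i + when (does (i Fin.≟ j)) c) ≈ prodOver A h + when (A j) (c * prodOver (remove A j) h)
  prodOver-perturb {suc m} A h c Fin.zero with A Fin.zero
  ... | true = begin
    (h Fin.zero + c) * prodOver (A ∘ Fin.suc) (λ i → h (Fin.suc i) + 0#)  ≈⟨ *-congˡ (drop-+0# A h) ⟩
    (h Fin.zero + c) * P                                ≈⟨ distribʳ P (h Fin.zero) c ⟩
    h Fin.zero * P + c * P                              ≈⟨ +-congˡ (*-congˡ (*-identityˡ P)) ⟨
    h Fin.zero * P + c * (1# * P)                       ∎
    where P = prodOver (A ∘ Fin.suc) (h ∘ Fin.suc)
  ... | false = begin
    1# * prodOver (A ∘ Fin.suc) (λ i → h (Fin.suc i) + 0#) ≈⟨ *-congˡ (drop-+0# A h) ⟩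
    1# * prodOver (A ∘ Fin.suc) (h ∘ Fin.suc)             ≈⟨ +-identityʳ _ ⟨
    1# * prodOver (A ∘ Fin.suc) (h ∘ Fin.suc) + 0#        ∎
  prodOver-perturb {suc m} A h c (Fin.suc j) = begin
    head′ * prodOver (A ∘ Fin.suc) (λ i → h (Fin.suc i) + when (does (i Fin.≟ j)) c)
      ≈⟨ *-cong (head-+0# (A Fin.zero)) (prodOver-perturb (A ∘ Fin.suc) (h ∘ Fin.suc) c j) ⟩
    head * (P + when (A (Fin.suc j)) (c * X))           ≈⟨ distribˡ head P _ ⟩
    head * P + head * when (A (Fin.suc j)) (c * X)      ≈⟨ +-congˡ (*-when (A (Fin.suc j)) head (c * X)) ⟩
    head * P + when (A (Fin.suc j)) (head * (c * X))    ≈⟨ +-congˡ (when-cong (A (Fin.suc j)) (*-CS.x∙yz≈y∙xz head c X)) ⟩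
    head * P + when (A (Fin.suc j)) (c * (head * X))    ∎
    where
    head′ = if A Fin.zero then h Fin.zero + 0# else 1#
    head  = if A Fin.zero then h Fin.zero else 1#
    P = prodOver (A ∘ Fin.suc) (h ∘ Fin.suc)
    X = prodOver (remove (A ∘ Fin.suc) j) (h ∘ Fin.suc)
    head-+0# : ∀ b → (if b then h Fin.zero + 0# else 1#) ≈ (if b then h Fin.zero else 1#)
    head-+0# true  = +-identityʳ _
    head-+0# false = refl

  sumOver : ∀ {a} {A : Set a} → List A → (A → Carrier) → Carrier
  sumOver xs f = sumL (map f xs)

  sumOver-cong : ∀ {a} {A : Set a} (xs : List A) {f g : A → Carrier} →
                 (∀ x → f x ≈ g x) → sumOver xs f ≈ sumOver xs g
  sumOver-cong []       f≈g = refl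
  sumOver-cong (x ∷ xs) f≈g = +-cong (f≈g x) (sumOver-cong xs f≈g)

  sumOver-zero : ∀ {a} {A : Set a} (xs : List A) → sumOver xs (λ _ → 0#) ≈ 0#
  sumOver-zero []       = refl
  sumOver-zero (x ∷ xs) = trans (+-identityˡ _) (sumOver-zero xs)

  sumOver-distrib-+ : ∀ {a} {A : Set a} (xs : List A) (f g : A → Carrier) →
                      sumOver xs (λ x → f x + g x) ≈ sumOver xs f + sumOver xs g
  sumOver-distrib-+ []       f g = sym (+-identityˡ 0#)
  sumOver-distrib-+ (x ∷ xs) f g =
    trans (+-congˡ (sumOver-distrib-+ xs f g)) (+-CS.interchange _ _ _ _)

  *-distribˡ-sumOver : ∀ {a} {A : Set a} (xs : List A) b (f : A → Carrier) →
                       b * sumOver xs f ≈ sumOver xs (λ x → b * f x)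
  *-distribˡ-sumOver []       b f = zeroʳ b
  *-distribˡ-sumOver (x ∷ xs) b f = trans (distribˡ b _ _) (+-congˡ (*-distribˡ-sumOver xs b f))

  sumOver-++ : ∀ {a} {A : Set a} (xs ys : List A) (f : A → Carrier) →
               sumOver (xs ++ ys) f ≈ sumOver xs f + sumOver ys f
  sumOver-++ []       ys f = sym (+-identityˡ _)
  sumOver-++ (x ∷ xs) ys f = trans (+-congˡ (sumOver-++ xs ys f)) (sym (+-assoc _ _ _))

  sumOver-concatMap : ∀ {a b} {A : Set a} {B : Set b} (h : A → List B) (xs : List A) (f : B → Carrier) →
                      sumOver (concatMap h xs) f ≈ sumOver xs (λ x → sumOver (h x) f)
  sumOver-concatMap h []       f = refl
  sumOver-concatMap h (x ∷ xs) f =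
    trans (sumOver-++ (h x) (concatMap h xs) f) (+-congˡ (sumOver-concatMap h xs f))

  sumOver-map : ∀ {a b} {A : Set a} {B : Set b} (h : A → B) (xs : List A) (f : B → Carrier) →
                sumOver (map h xs) f ≈ sumOver xs (f ∘ h)
  sumOver-map h xs f rewrite List.map-∘ {g = f} {f = h} xs = refl

  sumOver-filter : ∀ {a p} {A : Set a} {P : A → Set p} (P? : ∀ x → Dec (P x)) (xs : List A) (f : A → Carrier) →
                   sumOver (filter P? xs) f ≈ sumOver xs (λ x → when (does (P? x)) (f x))
  sumOver-filter P? []       f = refl
  sumOver-filter P? (x ∷ xs) f with does (P? x)
  ... | true  = +-congˡ (sumOver-filter P? xs f)
  ... | false = trans (sumOver-filter P? xs f) (sym (+-identityˡ _))

  sumOver-when : ∀ {a} {A : Set a} (xs : List A) b (f : A → Carrier) →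
                 sumOver xs (λ x → when b (f x)) ≈ when b (sumOver xs f)
  sumOver-when xs true  f = refl
  sumOver-when xs false f = sumOver-zero xs

  sumOver-sum : ∀ {a r} {A : Set a} (xs : List A) (f : A → Fin r → Carrier) →
                sumOver xs (λ x → sum (f x)) ≈ sum (λ i → sumOver xs (λ x → f x i))
  sumOver-sum {r = r} []       f = sym (sum-zero r)
  sumOver-sum         (x ∷ xs) f = trans (+-congˡ (sumOver-sum xs f)) (sym (∑-distrib-+ (f x) _))

module PowerSeries {c ℓ : Level} (R : CommutativeRing c ℓ) where
  open CommutativeRing R
  open Series R
  open RingSums R
  open import Relation.Binary.Reasoning.Setoid setoid

  ≋-setoid : Setoid c ℓ
  ≋-setoid = ≡-setoid ℕ (Trivial.indexedSetoid setoid)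

  open Setoid ≋-setoid public using () renaming (refl to ≋-refl; sym to ≋-sym; trans to ≋-trans)
  module ≋-Reasoning = SetoidReasoning ≋-setoid

  infixr 25 _⋆_
  _⋆_ : Carrier → PS → PS
  (a ⋆ f) k = a * f k

  shift : PS → PS
  shift f zero    = 0#
  shift f (suc k) = f k

  delay : ℕ → PS → PS
  delay zero    f = f
  delay (suc d) f = shift (delay d f)

  ·-sumBelow : ∀ f g k → (f · g) k ≈ sumBelow (suc k) (λ i → f i * g (k ∸ i))
  ·-sumBelow f g k = sumL-map-upTo (suc k) (λ i → f i * g (k ∸ i))

  ·-cong : ∀ {f f′ g g′} → f ≋ f′ → g ≋ g′ → (f · g) ≋ (f′ · g′)
  ·-cong f≋f′ g≋g′ k = sumOver-cong (upTo (suc k)) (λ i → *-cong (f≋f′ i) (g≋g′ (k ∸ i)))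

  ·-congˡ : ∀ g {f f′} → f ≋ f′ → (f · g) ≋ (f′ · g)
  ·-congˡ g f≋f′ = ·-cong f≋f′ ≋-refl

  ·-congʳ : ∀ f {g g′} → g ≋ g′ → (f · g) ≋ (f · g′)
  ·-congʳ f g≋g′ = ·-cong ≋-refl g≋g′

  ⋆-cong : ∀ a {f g} → f ≋ g → (a ⋆ f) ≋ (a ⋆ g)
  ⋆-cong a f≋g k = *-congˡ (f≋g k)

  shift-cong : ∀ {f g} → f ≋ g → shift f ≋ shift g
  shift-cong f≋g zero    = refl
  shift-cong f≋g (suc k) = f≋g k

  delay-cong : ∀ d {f g} → f ≋ g → delay d f ≋ delay d g
  delay-cong zero    f≋g = f≋g
  delay-cong (suc d) f≋g = shift-cong (delay-cong d f≋g)

  ·-identityʳ : ∀ f → (f · onePS) ≋ f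
  ·-identityʳ f k = trans (·-sumBelow f onePS k) (unit k f)
    where
    unit : ∀ k (f : PS) → sumBelow (suc k) (λ i → f i * onePS (k ∸ i)) ≈ f k
    unit zero    f = trans (+-identityʳ (f 0 * 1#)) (*-identityʳ (f 0))
    unit (suc k) f = trans (+-cong (zeroʳ (f 0)) (unit k (f ∘ suc))) (+-identityˡ (f (suc k)))

  ⋆-· : ∀ a f g → ((a ⋆ f) · g) ≋ (a ⋆ (f · g))
  ⋆-· a f g k = begin
    ((a ⋆ f) · g) k                                   ≈⟨ ·-sumBelow (a ⋆ f) g k ⟩
    sumBelow (suc k) (λ i → (a * f i) * g (k ∸ i))    ≈⟨ sumBelow-cong (suc k) (λ i → *-assoc a (f i) (g (k ∸ i))) ⟩
    sumBelow (suc k) (λ i → a * (f i * g (k ∸ i)))    ≈⟨ *-distribˡ-sumBelow (suc k) a (λ i → f i * g (k ∸ i)) ⟨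
    a * sumBelow (suc k) (λ i → f i * g (k ∸ i))      ≈⟨ *-congˡ (·-sumBelow f g k) ⟨
    (a ⋆ (f · g)) k                                   ∎

  ·-⋆ : ∀ a f g → (f · (a ⋆ g)) ≋ (a ⋆ (f · g))
  ·-⋆ a f g k = begin
    (f · (a ⋆ g)) k                                   ≈⟨ ·-sumBelow f (a ⋆ g) k ⟩
    sumBelow (suc k) (λ i → f i * (a * g (k ∸ i)))    ≈⟨ sumBelow-cong (suc k) (λ i → *-CS.x∙yz≈y∙xz (f i) a (g (k ∸ i))) ⟩
    sumBelow (suc k) (λ i → a * (f i * g (k ∸ i)))    ≈⟨ *-distribˡ-sumBelow (suc k) a (λ i → f i * g (k ∸ i)) ⟨
    a * sumBelow (suc k) (λ i → f i * g (k ∸ i))      ≈⟨ *-congˡ (·-sumBelow f g k) ⟨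
    (a ⋆ (f · g)) k                                   ∎

  ⋆-⋆ : ∀ a b f → (a ⋆ b ⋆ f) ≋ ((a * b) ⋆ f)
  ⋆-⋆ a b f k = sym (*-assoc a b (f k))

  ⋆-shift : ∀ a f → (a ⋆ shift f) ≋ shift (a ⋆ f)
  ⋆-shift a f zero    = zeroʳ a
  ⋆-shift a f (suc k) = refl

  ⋆-delay : ∀ a d f → (a ⋆ delay d f) ≋ delay d (a ⋆ f)
  ⋆-delay a zero    f k = refl
  ⋆-delay a (suc d) f k = trans (⋆-shift a (delay d f) k) (shift-cong (⋆-delay a d f) k)

  shift-· : ∀ f g → (shift f · g) ≋ shift (f · g)
  shift-· f g zero    = trans (·-sumBelow (shift f) g 0) (trans (+-identityʳ (0# * g 0)) (zeroˡ (g 0)))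
  shift-· f g (suc k) = begin
    (shift f · g) (suc k)                                     ≈⟨ ·-sumBelow (shift f) g (suc k) ⟩
    0# * g (suc k) + sumBelow (suc k) (λ i → f i * g (k ∸ i)) ≈⟨ +-congʳ (zeroˡ (g (suc k))) ⟩
    0# + sumBelow (suc k) (λ i → f i * g (k ∸ i))             ≈⟨ +-identityˡ _ ⟩
    sumBelow (suc k) (λ i → f i * g (k ∸ i))                  ≈⟨ ·-sumBelow f g k ⟨
    (f · g) k                                                 ∎

  ·-shift : ∀ f g → (f · shift g) ≋ shift (f · g)
  ·-shift f g zero    = trans (·-sumBelow f (shift g) 0) (trans (+-identityʳ (f 0 * 0#)) (zeroʳ (f 0)))
  ·-shift f g (suc k) = trans (·-sumBelow f (shift g) (suc k)) (trans (convolution k f) (sym (·-sumBelow f g k)))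
    where
    convolution : ∀ k (f : PS) → sumBelow (suc (suc k)) (λ i → f i * shift g (suc k ∸ i))
                                ≈ sumBelow (suc k) (λ i → f i * g (k ∸ i))
    convolution zero    f = +-congˡ (trans (+-identityʳ (f 1 * 0#)) (zeroʳ (f 1)))
    convolution (suc k) f = +-congˡ (convolution k (f ∘ suc))

  ·-delay : ∀ f d g → (f · delay d g) ≋ delay d (f · g)
  ·-delay f zero    g k = refl
  ·-delay f (suc d) g k = trans (·-shift f (delay d g) k) (shift-cong (·-delay f d g) k)

  delay-⋆-· : ∀ d a f {g h} → delay d (a ⋆ g) ≋ h → delay d (a ⋆ (f · g)) ≋ (f · h)
  delay-⋆-· d a f {g} g≋h =
    ≋-trans (≋-sym (delay-cong d (·-⋆ a f g))) (≋-trans (≋-sym (·-delay f d (a ⋆ g))) (·-congʳ f g≋h))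

  monomial-· : ∀ a d f → (monomial a d · f) ≋ delay d (a ⋆ f)
  monomial-· a zero    f k = begin
    (monomial a 0 · f) k                                    ≈⟨ ·-sumBelow (monomial a 0) f k ⟩
    a * f k + sumBelow k (λ i → 0# * f (k ∸ suc i))          ≈⟨ +-congˡ (sumBelow-cong k (λ i → zeroˡ (f (k ∸ suc i)))) ⟩
    a * f k + sumBelow k (λ _ → 0#)                          ≈⟨ +-congˡ (sum-zero k) ⟩
    a * f k + 0#                                             ≈⟨ +-identityʳ (a * f k) ⟩
    a * f k                                                  ∎
  monomial-· a (suc d) f k = begin
    (monomial a (suc d) · f) k                ≈⟨ ·-congˡ f monomial-suc k ⟩
    (shift (monomial a d) · f) k              ≈⟨ shift-· (monomial a d) f k ⟩
    shift (monomial a d · f) k                ≈⟨ shift-cong (monomial-· a d f) k ⟩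
    delay (suc d) (a ⋆ f) k                   ∎
    where
    monomial-suc : monomial a (suc d) ≋ shift (monomial a d)
    monomial-suc zero    = refl
    monomial-suc (suc k) = refl

ℤ-downward-induction : ∀ {a} (P : ℤ → Set a) m → (∀ p → + m ℤ.≤ p → P p) →
                       (∀ v → P (ℤ.suc v) → P v) → ∀ p → P p
ℤ-downward-induction P m top step p = below-by (bound p) p (ℤ≤-bound p)
  where
  bound : ℤ → ℕ
  bound (+ k)     = m
  bound -[1+ k ]  = suc k ℕ.+ m
  ℤ≤-bound : ∀ p → + m ℤ.≤ p ℤ.+ + bound p
  ℤ≤-bound (+ k)    = ℤ.+≤+ (ℕ.m≤n+m m k)
  ℤ≤-bound -[1+ k ] =
    ℤ.≤-reflexive (≡.sym (≡.trans (ℤ.⊖-≥ (ℕ.m≤m+n (suc k) m)) (≡.cong +_ (ℕ.m+n∸m≡n (suc k) m))))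
  below-by : ∀ t p → + m ℤ.≤ p ℤ.+ + t → P p
  below-by zero    p m≤p = top p (≡.subst (+ m ℤ.≤_) (ℤ.+-identityʳ p) m≤p)
  below-by (suc t) p m≤p = step p (below-by t (ℤ.suc p) (≡.subst (+ m ℤ.≤_) (p+[1+t]≡[1+p]+t) m≤p))
    where
    p+[1+t]≡[1+p]+t : p ℤ.+ + suc t ≡ ℤ.suc p ℤ.+ + t
    p+[1+t]≡[1+p]+t = ≡.trans (≡.sym (ℤ.+-assoc p (+ 1) (+ t))) (≡.cong (ℤ._+ + t) (ℤ.+-comm p (+ 1)))

module SignedLetters {n : ℕ} where

  below : ℤ → SLetter n → Bool
  below p x = does (sval x ℤ.<? p)

  sval-injective : ∀ {x y : SLetter n} → sval x ≡ sval y → x ≡ y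
  sval-injective {false , a} {false , b} eq =
    ≡.cong (false ,_) (Fin.toℕ-injective (ℕ.suc-injective (ℤ.+-injective eq)))
  sval-injective {true , a}  {true , b}  eq = ≡.cong (true ,_) (Fin.toℕ-injective (ℤ.-[1+-injective eq))
  sval-injective {false , a} {true , b}  ()
  sval-injective {true , a}  {false , b} ()

  letterWithValue : ∀ v → (∃ λ (x : SLetter n) → sval x ≡ v) ⊎ (∀ (x : SLetter n) → sval x ≢ v)
  letterWithValue (+ zero) = inj₂ λ { (false , a) () ; (true , a) () }
  letterWithValue (+ suc m) with m ℕ.<? n
  ... | yes m<n = inj₁ ((false , Fin.fromℕ< m<n) , ≡.cong (λ t → + suc t) (Fin.toℕ-fromℕ< m<n))
  ... | no  m≮n = inj₂ λ
    { (false , a) eq → m≮n (≡.subst (ℕ._< n) (ℕ.suc-injective (ℤ.+-injective eq)) (Fin.toℕ<n a))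
    ; (true , a) () }
  letterWithValue -[1+ m ] with m ℕ.<? n
  ... | yes m<n = inj₁ ((true , Fin.fromℕ< m<n) , ≡.cong -[1+_] (Fin.toℕ-fromℕ< m<n))
  ... | no  m≮n = inj₂ λ
    { (false , a) ()
    ; (true , a) eq → m≮n (≡.subst (ℕ._< n) (ℤ.-[1+-injective eq) (Fin.toℕ<n a)) }

  below-suc : ∀ (x : SLetter n) v → sval x ≢ v → below (ℤ.suc v) x ≡ below v x
  below-suc x v x≢v = does-⇔ (mk⇔ x<1+v⇒x<v (λ x<v → ℤ.<-≤-trans x<v (ℤ.i≤suc[i] v)))
    (sval x ℤ.<? ℤ.suc v) (sval x ℤ.<? v)
    where
    x<1+v⇒x<v : sval x ℤ.< ℤ.suc v → sval x ℤ.< v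
    x<1+v⇒x<v x<1+v = ℤ.≤∧≢⇒< (≡.subst (sval x ℤ.≤_) (ℤ.pred-suc v) (ℤ.i<j⇒i≤pred[j] x<1+v)) x≢v

  below-other : ∀ (x y : SLetter n) → y ≢ x → below (sval x) y ≡ below (ℤ.suc (sval x)) y
  below-other x y y≢x = ≡.sym (below-suc y (sval x) (y≢x ∘ sval-injective))

  below-self : ∀ (x : SLetter n) → below (sval x) x ≡ false
  below-self x = dec-false (sval x ℤ.<? sval x) (ℤ.<-irrefl ≡.refl)

  below-suc-self : ∀ (x : SLetter n) → below (ℤ.suc (sval x)) x ≡ true
  below-suc-self x = dec-true (sval x ℤ.<? ℤ.suc (sval x)) (ℤ.suc[i]≤j⇒i<j ℤ.≤-refl)

  below-top : ∀ p → + suc n ℤ.≤ p → ∀ (x : SLetter n) → below p x ≡ true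
  below-top p n<p x = dec-true (sval x ℤ.<? p) (ℤ.<-≤-trans (sval<1+n x) n<p)
    where
    sval<1+n : ∀ (x : SLetter n) → sval x ℤ.< + suc n
    sval<1+n (false , a) = ℤ.+<+ (ℕ.s≤s (Fin.toℕ<n a))
    sval<1+n (true , a)  = ℤ.-<+

  below-bottom : ∀ (x : SLetter n) → below -[1+ n ] x ≡ false
  below-bottom x = dec-false (sval x ℤ.<? -[1+ n ]) (sval≮-1-n x)
    where
    sval≮-1-n : ∀ (x : SLetter n) → ¬ (sval x ℤ.< -[1+ n ])
    sval≮-1-n (false , a) ()
    sval≮-1-n (true , a) (ℤ.-<- n<a) = ℕ.<-asym n<a (Fin.toℕ<n a)

module Expansion {c ℓ : Level} (R : CommutativeRing c ℓ) {n : ℕ}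
                 (s : CommutativeRing.Carrier R) (zp zmInv : Fin n → CommutativeRing.Carrier R) where
  open CommutativeRing R
  open Series R
  open Vars s zp zmInv
  open RingSums R
  open PowerSeries R
  open SignedLetters

  admissible : Bool → ℕ → Bool
  admissible false _ = true
  admissible true  b = 0 <ᵇ b

  stepSeries : Bool → Carrier → PS
  stepSeries strict M b = when (admissible strict b) (pow M b)

  stepSeries-strict : ∀ M → stepSeries true M ≋ shift (M ⋆ geom M)
  stepSeries-strict M zero    = refl
  stepSeries-strict M (suc b) = refl

  partitionSeries : ℤ → List (SLetter n) → PS
  partitionSeries p []       = geom 1#
  partitionSeries p (x ∷ xs) = stepSeries (below p x) (mprod (x ∷ xs)) · partitionSeries (sval x) xs

  descentCount : ℤ → List (SLetter n) → ℕ
  descentCount p w = length (desSuffixes p w)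

  descentWeight : ℤ → List (SLetter n) → Carrier
  descentWeight p w = prodL (map mprod (desSuffixes p w))

  suffixSeries : List (SLetter n) → PS
  suffixSeries w = prodPS (map (λ u → geom (mprod u)) (suffixes w))

  descentPart : ℤ → List (SLetter n) → PS
  descentPart p w = delay (descentCount p w) (descentWeight p w ⋆ suffixSeries w)

  -- Each suffix M contributes 1/(1 - z₀M), times z₀M when it starts at a descent: Σ_{b ≥ [descent]} (z₀M)^b.
  descentPart≋partitionSeries : ∀ p w → descentPart p w ≋ partitionSeries p w
  descentPart≋partitionSeries p [] k = trans (*-identityˡ _) (·-identityʳ (geom 1#) k)
  descentPart≋partitionSeries p (x ∷ xs) with does (sval x ℤ.<? p)
  ... | false = delay-⋆-· (descentCount (sval x) xs) (descentWeight (sval x) xs) (geom (mprod (x ∷ xs)))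
                  (descentPart≋partitionSeries (sval x) xs)
  ... | true  = begin
    shift (delay d ((M * c′) ⋆ (geom M · G)))  ≈⟨ shift-cong (delay-cong d (⋆-⋆ M c′ (geom M · G))) ⟨
    shift (delay d (M ⋆ c′ ⋆ (geom M · G)))    ≈⟨ shift-cong (⋆-delay M d (c′ ⋆ (geom M · G))) ⟨
    shift (M ⋆ delay d (c′ ⋆ (geom M · G)))    ≈⟨ shift-cong (⋆-cong M (delay-⋆-· d c′ (geom M) IH)) ⟩
    shift (M ⋆ (geom M · P))                   ≈⟨ shift-cong (⋆-· M (geom M) P) ⟨
    shift ((M ⋆ geom M) · P)                   ≈⟨ shift-· (M ⋆ geom M) P ⟨
    (shift (M ⋆ geom M) · P)                   ≈⟨ ·-congˡ P (stepSeries-strict M) ⟨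
    (stepSeries true M · P)                    ∎
    where
    open ≋-Reasoning
    d = descentCount (sval x) xs
    c′ = descentWeight (sval x) xs
    M = mprod (x ∷ xs)
    G = suffixSeries xs
    P = partitionSeries (sval x) xs
    IH = descentPart≋partitionSeries (sval x) xs

  term≋partitionSeries : ∀ w → term w ≋ (pow s (negCount w) ⋆ partitionSeries (+ 0) w)
  term≋partitionSeries w = begin
    term w                                  ≈⟨ monomial-· (σ * c′) d (suffixSeries w) ⟩
    delay d ((σ * c′) ⋆ suffixSeries w)     ≈⟨ delay-cong d (⋆-⋆ σ c′ (suffixSeries w)) ⟨
    delay d (σ ⋆ c′ ⋆ suffixSeries w)       ≈⟨ ⋆-delay σ d (c′ ⋆ suffixSeries w) ⟨
    (σ ⋆ descentPart (+ 0) w)               ≈⟨ ⋆-cong σ (descentPart≋partitionSeries (+ 0) w) ⟩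
    (σ ⋆ partitionSeries (+ 0) w)           ∎
    where
    open ≋-Reasoning
    σ = pow s (negCount w)
    d = descentCount (+ 0) w
    c′ = descentWeight (+ 0) w

module FirstLetter {c ℓ : Level} (R : CommutativeRing c ℓ) {n : ℕ}
                   (s : CommutativeRing.Carrier R) (zp zmInv : Fin n → CommutativeRing.Carrier R) where
  open CommutativeRing R
  open Series R
  open Vars s zp zmInv
  open RingSums R
  open FinSubsets
  open SignedLetters
  open Expansion R s zp zmInv using (admissible)
  open import Relation.Binary.Reasoning.Setoid setoid

  isNeg : SLetter n → ℕ
  isNeg (b , _) = if b then 1 else 0

  sumSigns : (SLetter n → Carrier) → Fin n → Carrier
  sumSigns f j = f (false , j) + f (true , j)

  heightSum : Bool → ℕ → (ℕ → Carrier) → Carrier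
  heightSum strict r f = sumBelow (suc r) (λ b → when (admissible strict b) (f b))

  letterHeights : Bool → ℕ → ℕ → SLetter n → Carrier
  letterHeights strict lo r x = pow s (isNeg x) * heightSum strict r (λ b → pow (var x) (b ℕ.+ lo))

  letterFactor : (SLetter n → Bool) → ℕ → ℕ → Fin n → Carrier
  letterFactor D lo r = sumSigns (λ x → letterHeights (D x) lo r x)

  -- x is the first letter (lowest height, and among those the smallest value) of the
  -- letters drawn from A; the others then lie strictly above x when their value is smaller.
  firstLetterTerm : (Fin n → Bool) → Bool → ℕ → ℕ → SLetter n → Carrier
  firstLetterTerm A strict lo r x = when (A (proj₂ x)) (pow s (isNeg x) * heightSum strict r (λ b →
    pow (var x) (b ℕ.+ lo) * prodOver (remove A (proj₂ x)) (letterFactor (below (sval x)) (b ℕ.+ lo) (r ∸ b))))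

  firstLetterSum : (Fin n → Bool) → (SLetter n → Bool) → ℕ → ℕ → Carrier
  firstLetterSum A D lo r = sum (sumSigns (λ x → firstLetterTerm A (D x) lo r x))

  -- prodOver A (λ _ → 0#) is 1 exactly when A is empty: the contribution of the empty word.
  FirstLetterExpansion : (Fin n → Bool) → (SLetter n → Bool) → ℕ → ℕ → Set ℓ
  FirstLetterExpansion A D lo r = firstLetterSum A D lo r + prodOver A (λ _ → 0#) ≈ prodOver A (letterFactor D lo r)

  heightSum-cong : ∀ strict r {f g : ℕ → Carrier} → (∀ b → f b ≈ g b) → heightSum strict r f ≈ heightSum strict r g
  heightSum-cong strict r f≈g = sumBelow-cong (suc r) (λ b → when-cong (admissible strict b) (f≈g b))

  heightSum-zero : ∀ strict r → heightSum strict r (λ _ → 0#) ≈ 0#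
  heightSum-zero strict r = trans (sumBelow-cong (suc r) (λ b → when-0# (admissible strict b))) (sum-zero (suc r))

  heightSum-nonstrict : ∀ a σ r f →
    when a (σ * heightSum false r f) ≈ when a (σ * heightSum true r f) + when a (σ * f 0)
  heightSum-nonstrict false σ r f = sym (+-identityʳ 0#)
  heightSum-nonstrict true  σ r f = begin
    σ * (f 0 + S)               ≈⟨ distribˡ σ (f 0) S ⟩
    σ * f 0 + σ * S             ≈⟨ +-comm _ _ ⟩
    σ * S + σ * f 0             ≈⟨ +-congʳ (*-congˡ (+-identityˡ S)) ⟨
    σ * (0# + S) + σ * f 0      ∎
    where S = sumBelow r (f ∘ suc)

  heightSum-strict-suc : ∀ r f → heightSum true (suc r) f ≈ heightSum false r (f ∘ suc)
  heightSum-strict-suc r f = +-identityˡ _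

  sumSigns-cong : ∀ {f g : SLetter n → Carrier} → (∀ x → f x ≈ g x) → ∀ j → sumSigns f j ≈ sumSigns g j
  sumSigns-cong f≈g j = +-cong (f≈g (false , j)) (f≈g (true , j))

  sumSigns-perturb : ∀ (f g : SLetter n → Carrier) x₀ e → (∀ y → y ≢ x₀ → f y ≈ g y) → f x₀ ≈ g x₀ + e →
                     ∀ j → sumSigns f j ≈ sumSigns g j + when (does (j Fin.≟ proj₂ x₀)) e
  sumSigns-perturb f g (b₀ , j₀) e f≈g f≈g+e j with j Fin.≟ j₀
  ... | no j≢j₀ = trans (+-cong (f≈g (false , j) (j≢j₀ ∘ ≡.cong proj₂)) (f≈g (true , j) (j≢j₀ ∘ ≡.cong proj₂)))
                        (sym (+-identityʳ _))
  sumSigns-perturb f g (false , j) e f≈g f≈g+e j | yes ≡.refl = begin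
    f (false , j) + f (true , j)          ≈⟨ +-cong f≈g+e (f≈g (true , j) (λ ())) ⟩
    (g (false , j) + e) + g (true , j)    ≈⟨ +-CS.xy∙z≈xz∙y _ _ _ ⟩
    (g (false , j) + g (true , j)) + e    ∎
  sumSigns-perturb f g (true , j) e f≈g f≈g+e j | yes ≡.refl = begin
    f (false , j) + f (true , j)          ≈⟨ +-cong (f≈g (false , j) (λ ())) f≈g+e ⟩
    g (false , j) + (g (true , j) + e)    ≈⟨ +-assoc _ _ _ ⟨
    (g (false , j) + g (true , j)) + e    ∎

  firstLetterSum-cong : ∀ A {D D′} lo r → (∀ x → D x ≡ D′ x) → firstLetterSum A D lo r ≈ firstLetterSum A D′ lo r
  firstLetterSum-cong A lo r D≗D′ =
    sum-cong-≋ (sumSigns-cong (λ x → reflexive (≡.cong (λ δ → firstLetterTerm A δ lo r x) (D≗D′ x))))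

  letterFactor-cong : ∀ {D D′} lo r → (∀ x → D x ≡ D′ x) → ∀ j → letterFactor D lo r j ≈ letterFactor D′ lo r j
  letterFactor-cong lo r D≗D′ = sumSigns-cong (λ x → reflexive (≡.cong (λ δ → letterHeights δ lo r x) (D≗D′ x)))

  firstLetterExpansion-cong : ∀ A {D D′} lo r → (∀ x → D x ≡ D′ x) →
                              FirstLetterExpansion A D lo r → FirstLetterExpansion A D′ lo r
  firstLetterExpansion-cong A {D} {D′} lo r D≗D′ expansion = begin
    firstLetterSum A D′ lo r + prodOver A (λ _ → 0#) ≈⟨ +-congʳ (firstLetterSum-cong A lo r D≗D′) ⟨
    firstLetterSum A D lo r + prodOver A (λ _ → 0#)  ≈⟨ expansion ⟩
    prodOver A (letterFactor D lo r)                 ≈⟨ prodOver-cong A (λ j _ → letterFactor-cong lo r D≗D′ j) ⟩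
    prodOver A (letterFactor D′ lo r)                ∎

  firstLetterExpansion-strict-zero : ∀ A lo → FirstLetterExpansion A (λ _ → true) lo 0
  firstLetterExpansion-strict-zero A lo = begin
    firstLetterSum A (λ _ → true) lo 0 + prodOver A (λ _ → 0#) ≈⟨ +-congʳ noTerms ⟩
    0# + prodOver A (λ _ → 0#)                                  ≈⟨ +-identityˡ _ ⟩
    prodOver A (λ _ → 0#)                                       ≈⟨ prodOver-cong A (λ j _ → noHeights j) ⟨
    prodOver A (letterFactor (λ _ → true) lo 0)                 ∎
    where
    noHeights : ∀ j → letterFactor (λ _ → true) lo 0 j ≈ 0#
    noHeights j = trans (sumSigns-cong (λ x → trans (*-congˡ (+-identityʳ 0#)) (zeroʳ (pow s (isNeg x)))) j) (+-identityʳ 0#)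
    noTerm : ∀ x → firstLetterTerm A true lo 0 x ≈ 0#
    noTerm x = trans (when-cong (A (proj₂ x)) (trans (*-congˡ (+-identityʳ 0#)) (zeroʳ _))) (when-0# (A (proj₂ x)))
    noTerms : firstLetterSum A (λ _ → true) lo 0 ≈ 0#
    noTerms = trans (sum-cong-≋ (λ j → trans (sumSigns-cong noTerm j) (+-identityʳ 0#))) (sum-zero n)

  firstLetterExpansion-strict-suc : ∀ A lo r → FirstLetterExpansion A (λ _ → false) (suc lo) r →
                                    FirstLetterExpansion A (λ _ → true) lo (suc r)
  firstLetterExpansion-strict-suc A lo r expansion = begin
    firstLetterSum A (λ _ → true) lo (suc r) + Z   ≈⟨ +-congʳ (sum-cong-≋ (sumSigns-cong termsShift)) ⟩
    firstLetterSum A (λ _ → false) (suc lo) r + Z  ≈⟨ expansion ⟩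
    prodOver A (letterFactor (λ _ → false) (suc lo) r) ≈⟨ prodOver-cong A (λ j _ → sumSigns-cong heightsShift j) ⟨
    prodOver A (letterFactor (λ _ → true) lo (suc r))  ∎
    where
    Z = prodOver A (λ _ → 0#)
    heightsShift : ∀ x → letterHeights true lo (suc r) x ≈ letterHeights false (suc lo) r x
    heightsShift x = *-congˡ (trans (heightSum-strict-suc r (λ b → pow (var x) (b ℕ.+ lo)))
      (heightSum-cong false r (λ b → reflexive (≡.cong (pow (var x)) (≡.sym (ℕ.+-suc b lo))))))
    termsShift : ∀ x → firstLetterTerm A true lo (suc r) x ≈ firstLetterTerm A false (suc lo) r x
    termsShift x = when-cong (A (proj₂ x)) (*-congˡ (trans (heightSum-strict-suc r (λ b → rest b (b ℕ.+ lo)))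
      (heightSum-cong false r (λ b → reflexive (≡.cong (rest (suc b)) (≡.sym (ℕ.+-suc b lo)))))))
      where
      rest : ℕ → ℕ → Carrier
      rest b h = pow (var x) h * prodOver (remove A (proj₂ x)) (letterFactor (below (sval x)) h (suc r ∸ b))

  module _ (x₀ : SLetter n) where
    private
      j₀ = proj₂ x₀
      σ₀ = pow s (isNeg x₀)

    letterFactor-lower : ∀ lo r j → letterFactor (below (sval x₀)) lo r j
      ≈ letterFactor (below (ℤ.suc (sval x₀))) lo r j + when (does (j Fin.≟ j₀)) (σ₀ * pow (var x₀) lo)
    letterFactor-lower lo r = sumSigns-perturb _ _ x₀ _
      (λ y y≢x₀ → reflexive (≡.cong (λ δ → letterHeights δ lo r y) (below-other x₀ y y≢x₀)))
      (heightsAt (below-self x₀) (below-suc-self x₀))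
      where
      heightsAt : ∀ {δ δ′} → δ ≡ false → δ′ ≡ true →
                  letterHeights δ lo r x₀ ≈ letterHeights δ′ lo r x₀ + σ₀ * pow (var x₀) lo
      heightsAt ≡.refl ≡.refl = heightSum-nonstrict true σ₀ r (λ b → pow (var x₀) (b ℕ.+ lo))

    lowestTerm : (Fin n → Bool) → ℕ → ℕ → Carrier
    lowestTerm A lo r = when (A j₀) (σ₀ * (pow (var x₀) lo * prodOver (remove A j₀) (letterFactor (below (sval x₀)) lo r)))

    firstLetterSum-lower : ∀ A lo r →
      firstLetterSum A (below (sval x₀)) lo r ≈ firstLetterSum A (below (ℤ.suc (sval x₀))) lo r + lowestTerm A lo r
    firstLetterSum-lower A lo r = begin
      firstLetterSum A (below (sval x₀)) lo r                  ≈⟨ sum-cong-≋ termSplit ⟩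
      sum (λ j → T j + when (does (j Fin.≟ j₀)) e)             ≈⟨ ∑-distrib-+ T (λ j → when (does (j Fin.≟ j₀)) e) ⟩
      sum T + sum (λ j → when (does (j Fin.≟ j₀)) e)           ≈⟨ +-congˡ (sum-indicator j₀ e) ⟩
      firstLetterSum A (below (ℤ.suc (sval x₀))) lo r + e      ∎
      where
      e = lowestTerm A lo r
      T = sumSigns (λ x → firstLetterTerm A (below (ℤ.suc (sval x₀)) x) lo r x)
      termAt : ∀ {δ δ′} → δ ≡ false → δ′ ≡ true → firstLetterTerm A δ lo r x₀ ≈ firstLetterTerm A δ′ lo r x₀ + e
      termAt ≡.refl ≡.refl = heightSum-nonstrict (A j₀) σ₀ r
        (λ b → pow (var x₀) (b ℕ.+ lo) * prodOver (remove A j₀) (letterFactor (below (sval x₀)) (b ℕ.+ lo) (r ∸ b)))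
      termSplit : ∀ j → sumSigns (λ x → firstLetterTerm A (below (sval x₀) x) lo r x) j ≈ T j + when (does (j Fin.≟ j₀)) e
      termSplit = sumSigns-perturb _ _ x₀ e
        (λ y y≢x₀ → reflexive (≡.cong (λ δ → firstLetterTerm A δ lo r y) (below-other x₀ y y≢x₀)))
        (termAt (below-self x₀) (below-suc-self x₀))

  -- Lowering the threshold past the value of a letter x₀ only lets x₀ sit at the lowest height.
  firstLetterExpansion-step : ∀ A lo r v → FirstLetterExpansion A (below (ℤ.suc v)) lo r →
                              FirstLetterExpansion A (below v) lo r
  firstLetterExpansion-step A lo r v expansion with letterWithValue v
  ... | inj₂ noLetter = firstLetterExpansion-cong A lo r (λ x → below-suc x v (noLetter x)) expansion
  ... | inj₁ (x₀ , ≡.refl) = begin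
    firstLetterSum A Dv lo r + Z                                   ≈⟨ +-congʳ (firstLetterSum-lower x₀ A lo r) ⟩
    (firstLetterSum A Ds lo r + lowestTerm x₀ A lo r) + Z          ≈⟨ +-CS.xy∙z≈xz∙y _ _ _ ⟩
    (firstLetterSum A Ds lo r + Z) + lowestTerm x₀ A lo r          ≈⟨ +-cong expansion lowest≈ ⟩
    prodOver A Fs + when (A j₀) (c₀ * prodOver (remove A j₀) Fs)   ≈⟨ prodOver-perturb A Fs c₀ j₀ ⟨
    prodOver A (λ j → Fs j + when (does (j Fin.≟ j₀)) c₀)          ≈⟨ prodOver-cong A (λ j _ → letterFactor-lower x₀ lo r j) ⟨
    prodOver A (letterFactor Dv lo r)                              ∎
    where
    Dv = below (sval x₀)
    Ds = below (ℤ.suc (sval x₀))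
    j₀ = proj₂ x₀
    Z = prodOver A (λ _ → 0#)
    Fs = letterFactor Ds lo r
    c₀ = pow s (isNeg x₀) * pow (var x₀) lo
    lowest≈ : lowestTerm x₀ A lo r ≈ when (A j₀) (c₀ * prodOver (remove A j₀) Fs)
    lowest≈ = when-cong (A j₀) (trans (sym (*-assoc _ _ _)) (*-congˡ (prodOver-cong (remove A j₀) (λ j j∈A-j₀ → begin
      letterFactor Dv lo r j                      ≈⟨ letterFactor-lower x₀ lo r j ⟩
      Fs j + when (does (j Fin.≟ j₀)) c₀
        ≡⟨ ≡.cong (λ b → Fs j + when b c₀) (dec-false (j Fin.≟ j₀) (remove-∉ A j₀ j j∈A-j₀ ∘ ≡.sym)) ⟩
      Fs j + 0#                                   ≈⟨ +-identityʳ (Fs j) ⟩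
      Fs j                                        ∎))))

  firstLetterExpansion : ∀ r lo A p → FirstLetterExpansion A (below p) lo r
  firstLetterExpansion r lo A =
    ℤ-downward-induction (λ p → FirstLetterExpansion A (below p) lo r) (suc n)
      (λ p n<p → firstLetterExpansion-cong A lo r (λ x → ≡.sym (below-top p n<p x)) (allStrict r lo A))
      (λ v → firstLetterExpansion-step A lo r v)
    where
    allStrict : ∀ r lo A → FirstLetterExpansion A (λ _ → true) lo r
    allStrict zero    lo A = firstLetterExpansion-strict-zero A lo
    allStrict (suc r) lo A = firstLetterExpansion-strict-suc A lo r
      (firstLetterExpansion-cong A (suc lo) r below-bottom (firstLetterExpansion r (suc lo) A -[1+ n ]))

module Words {c ℓ : Level} (R : CommutativeRing c ℓ) {n : ℕ}
             (s : CommutativeRing.Carrier R) (zp zmInv : Fin n → CommutativeRing.Carrier R) where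
  open CommutativeRing R
  open Series R
  open Vars s zp zmInv
  open RingSums R
  open PowerSeries R using (·-sumBelow)
  open FinSubsets
  open SignedLetters
  open Expansion R s zp zmInv
  open FirstLetter R s zp zmInv
  open import Relation.Binary.Reasoning.Setoid setoid

  wordTerm : (Fin n → Bool) → ℤ → ℕ → ℕ → List (SLetter n) → Carrier
  wordTerm A p lo r w = when (drawsFrom A (map proj₂ w)) (pow s (negCount w) * (pow (mprod w) lo * partitionSeries p w r))

  wordSum : (Fin n → Bool) → ℕ → ℤ → ℕ → ℕ → Carrier
  wordSum A m p lo r = sumOver (allWords n m) (wordTerm A p lo r)

  pow-negCount-∷ : ∀ x w → pow s (negCount (x ∷ w)) ≈ pow s (isNeg x) * pow s (negCount w)
  pow-negCount-∷ (true  , a) w = *-congʳ (sym (*-identityʳ s))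
  pow-negCount-∷ (false , a) w = sym (*-identityˡ _)

  sumOver-letters : ∀ (f : SLetter n → Carrier) → sumOver (letters n) f ≈ sum (sumSigns f)
  sumOver-letters f = begin
    sumOver (letters n) f             ≈⟨ sumOver-concatMap (λ a → (false , a) ∷ (true , a) ∷ []) (allFin n) f ⟩
    sumOver (allFin n) signs          ≡⟨ ≡.cong sumL (List.map-tabulate Function.id signs) ⟩
    sumL (tabulate signs)             ≈⟨ sumL-tabulate signs ⟩
    sum signs                         ≈⟨ sum-cong-≋ {n} {signs} {sumSigns f} (λ a → +-congˡ (+-identityʳ _)) ⟩
    sum (sumSigns f)                  ∎
    where
    signs : Fin n → Carrier
    signs a = f (false , a) + (f (true , a) + 0#)

  sumOver-heightSum : ∀ (ws : List (List (SLetter n))) strict r (f : List (SLetter n) → ℕ → Carrier) →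
    sumOver ws (λ w → heightSum strict r (f w)) ≈ heightSum strict r (λ b → sumOver ws (λ w → f w b))
  sumOver-heightSum ws strict r f =
    trans (sumOver-sum ws (λ w (b : Fin (suc r)) → when (admissible strict (toℕ b)) (f w (toℕ b))))
          (sumBelow-cong (suc r) (λ b → sumOver-when ws (admissible strict b) (λ w → f w b)))

  wordTerm-∷ : ∀ A p lo r x w → A (proj₂ x) ≡ true →
    wordTerm A p lo r (x ∷ w) ≈ pow s (isNeg x) * heightSum (below p x) r (λ b →
      pow (var x) (b ℕ.+ lo) * wordTerm (remove A (proj₂ x)) (sval x) (b ℕ.+ lo) (r ∸ b) w)
  wordTerm-∷ A p lo r x w x∈A rewrite x∈A = go (drawsFrom (remove A (proj₂ x)) (map proj₂ w))
    where
    δ = below p x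
    σx = pow s (isNeg x)
    σw = pow s (negCount w)
    vx = var x
    M = mprod w
    P = partitionSeries (sval x) w
    go : ∀ o → when o (pow s (negCount (x ∷ w)) * (pow (vx * M) lo * partitionSeries p (x ∷ w) r))
             ≈ σx * heightSum δ r (λ b → pow vx (b ℕ.+ lo) * when o (σw * (pow M (b ℕ.+ lo) * P (r ∸ b))))
    go false = sym (trans (*-congˡ (trans (heightSum-cong δ r (λ b → zeroʳ (pow vx (b ℕ.+ lo)))) (heightSum-zero δ r)))
                          (zeroʳ σx))
    go true = begin
      pow s (negCount (x ∷ w)) * (L * partitionSeries p (x ∷ w) r)
        ≈⟨ *-cong (pow-negCount-∷ x w) (*-congˡ (·-sumBelow (stepSeries δ N) P r)) ⟩
      (σx * σw) * (L * sumBelow (suc r) (λ b → stepSeries δ N b * P (r ∸ b)))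
        ≈⟨ *-assoc σx σw _ ⟩
      σx * (σw * (L * sumBelow (suc r) (λ b → stepSeries δ N b * P (r ∸ b))))
        ≈⟨ *-congˡ (*-congˡ (*-distribˡ-sumBelow (suc r) L (λ b → stepSeries δ N b * P (r ∸ b)))) ⟩
      σx * (σw * sumBelow (suc r) (λ b → L * (stepSeries δ N b * P (r ∸ b))))
        ≈⟨ *-congˡ (*-distribˡ-sumBelow (suc r) σw (λ b → L * (stepSeries δ N b * P (r ∸ b)))) ⟩
      σx * sumBelow (suc r) (λ b → σw * (L * (stepSeries δ N b * P (r ∸ b))))
        ≈⟨ *-congˡ (sumBelow-cong (suc r) step) ⟩
      σx * heightSum δ r (λ b → pow vx (b ℕ.+ lo) * (σw * (pow M (b ℕ.+ lo) * P (r ∸ b)))) ∎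
      where
      N = vx * M
      L = pow N lo
      regroup : ∀ b → σw * (L * (pow N b * P (r ∸ b))) ≈ pow vx (b ℕ.+ lo) * (σw * (pow M (b ℕ.+ lo) * P (r ∸ b)))
      regroup b = begin
        σw * (L * (pow N b * P (r ∸ b)))                         ≈⟨ *-congˡ (*-CS.x∙yz≈yx∙z L (pow N b) _) ⟩
        σw * ((pow N b * L) * P (r ∸ b))                         ≈⟨ *-congˡ (*-congʳ (pow-homo-+ N b lo)) ⟨
        σw * (pow N (b ℕ.+ lo) * P (r ∸ b))                      ≈⟨ *-congˡ (*-congʳ (pow-distrib-* vx M (b ℕ.+ lo))) ⟩
        σw * ((pow vx (b ℕ.+ lo) * pow M (b ℕ.+ lo)) * P (r ∸ b)) ≈⟨ *-congˡ (*-assoc _ _ _) ⟩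
        σw * (pow vx (b ℕ.+ lo) * (pow M (b ℕ.+ lo) * P (r ∸ b))) ≈⟨ *-CS.x∙yz≈y∙xz _ _ _ ⟩
        pow vx (b ℕ.+ lo) * (σw * (pow M (b ℕ.+ lo) * P (r ∸ b))) ∎
      step : ∀ b → σw * (L * (stepSeries δ N b * P (r ∸ b)))
                 ≈ when (admissible δ b) (pow vx (b ℕ.+ lo) * (σw * (pow M (b ℕ.+ lo) * P (r ∸ b))))
      step b = begin
        σw * (L * (when a (pow N b) * P (r ∸ b)))   ≈⟨ *-congˡ (*-congˡ (when-* a (pow N b) (P (r ∸ b)))) ⟩
        σw * (L * when a (pow N b * P (r ∸ b)))     ≈⟨ *-congˡ (*-when a L _) ⟩
        σw * when a (L * (pow N b * P (r ∸ b)))     ≈⟨ *-when a σw _ ⟩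
        when a (σw * (L * (pow N b * P (r ∸ b))))   ≈⟨ when-cong a (regroup b) ⟩
        when a (pow vx (b ℕ.+ lo) * (σw * (pow M (b ℕ.+ lo) * P (r ∸ b)))) ∎
        where a = admissible δ b

  wordSum≈prodOver : ∀ m A → size A ≡ m → ∀ p lo r → wordSum A m p lo r ≈ prodOver A (letterFactor (below p) lo r)
  wordSum≈prodOver zero A ∣A∣≡0 p lo r = begin
    1# * (pow 1# lo * pow 1# r) + 0#          ≈⟨ +-identityʳ _ ⟩
    1# * (pow 1# lo * pow 1# r)               ≈⟨ *-identityˡ _ ⟩
    pow 1# lo * pow 1# r                      ≈⟨ *-cong (pow-1# lo) (pow-1# r) ⟩
    1# * 1#                                   ≈⟨ *-identityˡ 1# ⟩
    1#                                        ≈⟨ prodOver-empty A _ ∣A∣≡0 ⟨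
    prodOver A (letterFactor (below p) lo r)  ∎
  wordSum≈prodOver (suc m) A ∣A∣≡1+m p lo r = begin
    wordSum A (suc m) p lo r
      ≈⟨ sumOver-concatMap (λ w → map (_∷ w) (letters n)) W F ⟩
    sumOver W (λ w → sumOver (map (_∷ w) (letters n)) F)
      ≈⟨ sumOver-cong W (λ w → trans (sumOver-map (_∷ w) (letters n) F) (sumOver-letters (λ x → F (x ∷ w)))) ⟩
    sumOver W (λ w → sum (sumSigns (λ x → F (x ∷ w))))
      ≈⟨ sumOver-sum W (λ w → sumSigns (λ x → F (x ∷ w))) ⟩
    sum (λ j → sumOver W (λ w → sumSigns (λ x → F (x ∷ w)) j))
      ≈⟨ sum-cong-≋ (λ j → sumOver-distrib-+ W (λ w → F ((false , j) ∷ w)) (λ w → F ((true , j) ∷ w))) ⟩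
    sum (sumSigns (λ x → sumOver W (λ w → F (x ∷ w))))
      ≈⟨ sum-cong-≋ (sumSigns-cong (λ x → startingWith x (A (proj₂ x)) ≡.refl)) ⟩
    firstLetterSum A (below p) lo r                           ≈⟨ +-identityʳ _ ⟨
    firstLetterSum A (below p) lo r + 0#                      ≈⟨ +-congˡ (prodOver-zero A ∣A∣≡1+m) ⟨
    firstLetterSum A (below p) lo r + prodOver A (λ _ → 0#)   ≈⟨ firstLetterExpansion r lo A p ⟩
    prodOver A (letterFactor (below p) lo r)                  ∎
    where
    W = allWords n m
    F = wordTerm A p lo r
    startingWith : ∀ x b → A (proj₂ x) ≡ b → sumOver W (λ w → F (x ∷ w)) ≈ firstLetterTerm A (below p x) lo r x
    startingWith x false x∉A rewrite x∉A = sumOver-zero W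
    startingWith x true  x∈A = begin
      sumOver W (λ w → F (x ∷ w))
        ≈⟨ sumOver-cong W (λ w → wordTerm-∷ A p lo r x w x∈A) ⟩
      sumOver W (λ w → σx * heightSum δ r (λ b → pow vx (b ℕ.+ lo) * wordTerm A′ (sval x) (b ℕ.+ lo) (r ∸ b) w))
        ≈⟨ *-distribˡ-sumOver W σx _ ⟨
      σx * sumOver W (λ w → heightSum δ r (λ b → pow vx (b ℕ.+ lo) * wordTerm A′ (sval x) (b ℕ.+ lo) (r ∸ b) w))
        ≈⟨ *-congˡ (sumOver-heightSum W δ r (λ w b → pow vx (b ℕ.+ lo) * wordTerm A′ (sval x) (b ℕ.+ lo) (r ∸ b) w)) ⟩
      σx * heightSum δ r (λ b → sumOver W (λ w → pow vx (b ℕ.+ lo) * wordTerm A′ (sval x) (b ℕ.+ lo) (r ∸ b) w))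
        ≈⟨ *-congˡ (heightSum-cong δ r (λ b → trans (sym (*-distribˡ-sumOver W (pow vx (b ℕ.+ lo)) _))
                                                   (*-congˡ (IH (sval x) (b ℕ.+ lo) (r ∸ b))))) ⟩
      σx * heightSum δ r (λ b → pow vx (b ℕ.+ lo) * prodOver A′ (letterFactor (below (sval x)) (b ℕ.+ lo) (r ∸ b)))
        ≈⟨ when-true _ x∈A ⟨
      firstLetterTerm A (below p x) lo r x ∎
      where
      δ = below p x
      σx = pow s (isNeg x)
      vx = var x
      A′ = remove A (proj₂ x)
      IH = wordSum≈prodOver m A′ (ℕ.suc-injective (≡.trans (size-remove A (proj₂ x) x∈A) ∣A∣≡1+m))

module Identity {c ℓ : Level} (R : CommutativeRing c ℓ) {n : ℕ}
                (s : CommutativeRing.Carrier R) (zp zmInv : Fin n → CommutativeRing.Carrier R) where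
  open CommutativeRing R
  open Series R
  open Vars s zp zmInv
  open RingSums R
  open FinSubsets
  open SignedLetters
  open Expansion R s zp zmInv
  open FirstLetter R s zp zmInv
  open Words R s zp zmInv
  open import Relation.Binary.Reasoning.Setoid setoid

  letterFactor-base : ∀ k j → letterFactor (below (+ 0)) 0 k j ≈ qint (suc k) (zp j) + s * zmInv j * qint k (zmInv j)
  letterFactor-base k j
    rewrite dec-false (sval (false , j) ℤ.<? + 0) (λ { (ℤ.+<+ ()) })
          | dec-true (sval (true , j) ℤ.<? + 0) ℤ.-<+ = +-cong positive negative
    where
    pow-+0 : ∀ x b → pow x (b ℕ.+ 0) ≈ pow x b
    pow-+0 x b = reflexive (≡.cong (pow x) (ℕ.+-identityʳ b))
    positive : 1# * sumBelow (suc k) (λ b → pow (zp j) (b ℕ.+ 0)) ≈ qint (suc k) (zp j)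
    positive = begin
      1# * sumBelow (suc k) (λ b → pow (zp j) (b ℕ.+ 0))  ≈⟨ *-identityˡ _ ⟩
      sumBelow (suc k) (λ b → pow (zp j) (b ℕ.+ 0))       ≈⟨ sumBelow-cong (suc k) (pow-+0 (zp j)) ⟩
      sumBelow (suc k) (pow (zp j))                        ≈⟨ sumL-map-upTo (suc k) (pow (zp j)) ⟨
      qint (suc k) (zp j)                                  ∎
    negative : (s * 1#) * (0# + sumBelow k (λ b → zmInv j * pow (zmInv j) (b ℕ.+ 0))) ≈ s * zmInv j * qint k (zmInv j)
    negative = begin
      (s * 1#) * (0# + sumBelow k (λ b → zmInv j * pow (zmInv j) (b ℕ.+ 0)))
        ≈⟨ *-cong (*-identityʳ s) (trans (+-identityˡ _) (sumBelow-cong k (λ b → *-congˡ (pow-+0 (zmInv j) b)))) ⟩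
      s * sumBelow k (λ b → zmInv j * pow (zmInv j) b)              ≈⟨ *-congˡ (*-distribˡ-sumBelow k (zmInv j) (pow (zmInv j))) ⟨
      s * (zmInv j * sumBelow k (pow (zmInv j)))                    ≈⟨ *-assoc s (zmInv j) _ ⟨
      s * zmInv j * sumBelow k (pow (zmInv j))                      ≈⟨ *-congˡ (sumL-map-upTo k (pow (zmInv j))) ⟨
      s * zmInv j * qint k (zmInv j)                                ∎

  coefficient : ∀ k → LHS k ≈ RHS k
  coefficient k = begin
    LHS k                                                  ≡⟨ ≡.cong prodL (List.map-tabulate Function.id factor) ⟩
    prodL (tabulate factor)                                ≈⟨ prodL-tabulate factor ⟩
    product factor                                         ≈⟨ product-cong-≋ {n} {_} {factor} (letterFactor-base k) ⟨
    prodOver (λ _ → true) (letterFactor (below (+ 0)) 0 k) ≈⟨ wordSum≈prodOver n (λ _ → true) (size-full n) (+ 0) 0 k ⟨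
    wordSum (λ _ → true) n (+ 0) 0 k                       ≈⟨ sumOver-cong (allWords n n) permutationTerm ⟩
    sumOver (allWords n n) (λ w → when (isPermutation w) (term w k))
                                                           ≈⟨ sumOver-filter (λ w → unique? (map proj₂ w)) (allWords n n) (λ w → term w k) ⟨
    sumOver (signedPerms n) (λ w → term w k)               ≈⟨ sumOver-map term (signedPerms n) (λ f → f k) ⟨
    RHS k                                                  ∎
    where
    open import Data.List.Relation.Unary.Unique.DecPropositional {A = Fin n} Fin._≟_ using (unique?)
    factor : Fin n → Carrier
    factor j = qint (suc k) (zp j) + s * zmInv j * qint k (zmInv j)
    isPermutation : List (SLetter n) → Bool
    isPermutation w = does (unique? (map proj₂ w))
    permutationTerm : ∀ w → wordTerm (λ _ → true) (+ 0) 0 k w ≈ when (isPermutation w) (term w k)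
    permutationTerm w rewrite unique?≡drawsFrom (map proj₂ w) =
      when-cong (drawsFrom (λ _ → true) (map proj₂ w))
        (trans (*-congˡ (*-identityˡ _)) (sym (term≋partitionSeries w k)))

theorem6p9 : ∀ {c ℓ : Level} (R : CommutativeRing c ℓ) (n : ℕ) → 1 ≤ n →
    (s : CommutativeRing.Carrier R) →
    (zp zpInv zm zmInv : Fin n → CommutativeRing.Carrier R) →
    (∀ j → CommutativeRing._≈_ R (CommutativeRing._*_ R (zp j) (zpInv j)) (CommutativeRing.1# R)) →
    (∀ j → CommutativeRing._≈_ R (CommutativeRing._*_ R (zm j) (zmInv j)) (CommutativeRing.1# R)) →
    Series._≋_ R (Series.Vars.LHS R s zp zmInv) (Series.Vars.RHS R s zp zmInv)
theorem6p9 R n _ s zp _ _ zmInv _ _ = Identity.coefficient R s zp zmInv
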